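{- Let $N=\{1,\dots,n\}$ and let $\mathcal{F}\subseteq 2^N$ be a family of subsets satisfying the exchange property: for any $X,Y\in\mathcal{F}$ and $i\in X\setminus Y$, either (i) $X-i\in\mathcal{F}$ and $Y+i\in\mathcal{F}$, or (ii) there exists $j\in Y\setminus X$ with $X-i+j\in\mathcal{F}$ and $Y+i-j\in\mathcal{F}$. Then $\mathcal{F}$ has the following properties: (a) if $X,Y\in\mathcal{F}$ and $|X|<|Y|$, there exists $j\in Y\setminus X$ with $Y-j\in\mathcal{F}$; (b) if $X,Y\in\mathcal{F}$, $|X|=|Y|$ and $X\ne Y$, there exist $i\in X\setminus Y$ and $j\in Y\setminus X$ with $Y+i-j\in\mathcal{F}$; (c) if $X,Y\in\mathcal{F}$, $|X|<|Y|$ and $X\setminus Y\neq\emptyset$, there exist $i\in X\setminus Y$ and $j\in Y\setminus X$ with $Y+i-j\in\mathcal{F}$.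
   Context: For $X\subseteq N$ and $i,j\in N$ write $X-i=X\setminus\{i\}$, $X+i=X\cup\{i\}$, $X-i+j=(X\setminus\{i\})\cup\{j\}$, $Y+i-j=(Y\cup\{i\})\setminus\{j\}$. -}

module Defs where

open import Data.Nat using (ℕ)
open import Data.Fin using (Fin)
open import Data.Fin.Subset using (Subset; _∈_; _∉_; _∪_; ⁅_⁆; _-_)
open import Data.Product using (Σ; _×_)
open import Data.Sum using (_⊎_)

infixl 5 _＋_
_＋_ : ∀ {n} → Subset n → Fin n → Subset n
X ＋ i = X ∪ ⁅ i ⁆

-- A family of subsets of N = Fin n, given as a predicate on subsets.
Family : ℕ → Set₁
Family n = Subset n → Set

Exchange : ∀ {n} → Family n → Set
Exchange {n} F =
  ∀ (X Y : Subset n) (i : Fin n) → F X → F Y → i ∈ X → i ∉ Y →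
    (F (X - i) × F (Y ＋ i))
    ⊎ Σ (Fin n) (λ j → j ∈ Y × j ∉ X × F (X - i ＋ j) × F (Y ＋ i - j))

{-# OPTIONS --safe #-}
-- Part (a) is an induction on |Y ∖ X|: exchanging an element j ∈ Y ∖ X out of Y
-- either deletes j from Y inside the family, or replaces X by X + j - k with k ∉ Y,
-- a member of the same size that is strictly closer to Y.  For (b) and (c) exchange
-- some i ∈ X ∖ Y out of X: either this already swaps i into Y, or Y + i is a member
-- larger than X, and (a) deletes from it an element j ∉ X, necessarily j ≠ i.
module Submission where

open import Defs
open import Data.Nat using (ℕ; _<_; _≤_; suc; s≤s)
open import Data.Nat.Induction using (<-wellFounded)
open import Data.Nat.Properties using (<⇒≱; ≤-reflexive; ≤-trans; n≤1+n; suc-injective)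
open import Data.Fin using (Fin; zero; suc)
open import Data.Fin.Subset using (Subset; _∈_; _∉_; _-_; ∣_∣; _─_; Nonempty; Empty; ⁅_⁆; _⊆_; _⊂_; inside; outside)
open import Data.Fin.Subset.Properties
  using (_∈?_; nonempty?; x∈p∧x∉q⇒x∈p─q; x∈p∧x≢y⇒x∈p-y; x∈p∪q⁺; x∈p∪q⁻; x∈⁅x⁆; x∈⁅y⁆⇒x≡y;
         ∪-identityʳ; p─⊥≡p; ⊆-antisym; p⊆q⇒∣p∣≤∣q∣; p⊂q⇒∣p∣<∣q∣)
open import Data.Vec using (_∷_; here; there)
open import Data.Product using (Σ; _×_; _,_; proj₁)
open import Data.Sum using (_⊎_; inj₁; inj₂)
open import Induction.WellFounded using (Acc; acc)
open import Relation.Binary.PropositionalEquality using (_≡_; _≢_; refl; cong; sym; trans; subst)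
open import Relation.Nullary using (¬_; yes; no; contradiction)

private
  variable
    n : ℕ

x∈p─q⁻ : ∀ (p q : Subset n) {x} → x ∈ p ─ q → x ∈ p × x ∉ q
x∈p─q⁻ (inside  ∷ p) (outside ∷ q)        here = here , λ ()
x∈p─q⁻ (outside ∷ p) (inside  ∷ q) {zero} ()
x∈p─q⁻ (outside ∷ p) (outside ∷ q) {zero} ()
x∈p─q⁻ (inside  ∷ p) (inside  ∷ q) {zero} ()
x∈p─q⁻ (_       ∷ p) (_       ∷ q)        (there x∈p─q) with x∈p─q⁻ p q x∈p─q
... | x∈p , x∉q = there x∈p , λ { (there x∈q) → x∉q x∈q }

Empty[p─q]⇒p⊆q : ∀ {p q : Subset n} → Empty (p ─ q) → p ⊆ q
Empty[p─q]⇒p⊆q {q = q} empty {x} x∈p with x ∈? q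
... | yes x∈q = x∈q
... | no x∉q = contradiction (x , x∈p∧x∉q⇒x∈p─q x∈p x∉q) empty

p⊆q∧∣q∣≤∣p∣⇒p≡q : ∀ {p q : Subset n} → p ⊆ q → ∣ q ∣ ≤ ∣ p ∣ → p ≡ q
p⊆q∧∣q∣≤∣p∣⇒p≡q {p = p} p⊆q ∣q∣≤∣p∣ = ⊆-antisym p⊆q q⊆p
  where
  q⊆p : _ ⊆ p
  q⊆p {x} x∈q with x ∈? p
  ... | yes x∈p = x∈p
  ... | no x∉p = contradiction ∣q∣≤∣p∣ (<⇒≱ (p⊂q⇒∣p∣<∣q∣ (p⊆q , x , x∈q , x∉p)))

x∈p⇒x∈p＋y : ∀ {p : Subset n} {x} y → x ∈ p → x ∈ p ＋ y
x∈p⇒x∈p＋y _ x∈p = x∈p∪q⁺ (inj₁ x∈p)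

x∈p＋x : ∀ (p : Subset n) x → x ∈ p ＋ x
x∈p＋x _ x = x∈p∪q⁺ (inj₂ (x∈⁅x⁆ x))

x∈p＋y⁻ : ∀ (p : Subset n) {x} y → x ∈ p ＋ y → x ∈ p ⊎ x ≡ y
x∈p＋y⁻ p y x∈p＋y with x∈p∪q⁻ p ⁅ y ⁆ x∈p＋y
... | inj₁ x∈p = inj₁ x∈p
... | inj₂ x∈⁅y⁆ = inj₂ (x∈⁅y⁆⇒x≡y y x∈⁅y⁆)

x∈p∧x≢z⇒x∈p＋y-z : ∀ {p : Subset n} {x} y {z} → x ∈ p → x ≢ z → x ∈ p ＋ y - z
x∈p∧x≢z⇒x∈p＋y-z y x∈p x≢z = x∈p∧x≢y⇒x∈p-y (x∈p⇒x∈p＋y y x∈p) x≢z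

∣p＋x∣≡1+∣p∣ : ∀ (p : Subset n) x → x ∉ p → ∣ p ＋ x ∣ ≡ suc ∣ p ∣
∣p＋x∣≡1+∣p∣ (outside ∷ p) zero    _   = cong (λ q → suc ∣ q ∣) (∪-identityʳ p)
∣p＋x∣≡1+∣p∣ (inside  ∷ p) zero    x∉p = contradiction here x∉p
∣p＋x∣≡1+∣p∣ (inside  ∷ p) (suc x) x∉p = cong suc (∣p＋x∣≡1+∣p∣ p x (λ x∈p → x∉p (there x∈p)))
∣p＋x∣≡1+∣p∣ (outside ∷ p) (suc x) x∉p = ∣p＋x∣≡1+∣p∣ p x (λ x∈p → x∉p (there x∈p))

x∈p⇒1+∣p-x∣≡∣p∣ : ∀ {p : Subset n} {x} → x ∈ p → suc ∣ p - x ∣ ≡ ∣ p ∣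
x∈p⇒1+∣p-x∣≡∣p∣ {p = inside  ∷ p} here        = cong (λ q → suc ∣ q ∣) (p─⊥≡p p)
x∈p⇒1+∣p-x∣≡∣p∣ {p = inside  ∷ p} (there x∈p) = cong suc (x∈p⇒1+∣p-x∣≡∣p∣ x∈p)
x∈p⇒1+∣p-x∣≡∣p∣ {p = outside ∷ p} (there x∈p) = x∈p⇒1+∣p-x∣≡∣p∣ x∈p

∣p＋x-y∣≡∣p∣ : ∀ {p : Subset n} {x y} → x ∉ p → y ∈ p → ∣ p ＋ x - y ∣ ≡ ∣ p ∣
∣p＋x-y∣≡∣p∣ {p = p} {x} x∉p y∈p =
  suc-injective (trans (x∈p⇒1+∣p-x∣≡∣p∣ (x∈p⇒x∈p＋y x y∈p)) (∣p＋x∣≡1+∣p∣ p x x∉p))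

q─[p＋x-y]⊂q─p : ∀ {p q : Subset n} {x y} → x ∈ q ─ p → y ∉ q → q ─ (p ＋ x - y) ⊂ q ─ p
q─[p＋x-y]⊂q─p {p = p} {q} {x} {y} x∈q─p y∉q = shrinks , x , x∈q─p , x∉q─[p＋x-y]
  where
  x∈q : x ∈ q
  x∈q = proj₁ (x∈p─q⁻ q p x∈q─p)
  ≢y : ∀ {z} → z ∈ q → z ≢ y
  ≢y z∈q refl = y∉q z∈q
  shrinks : q ─ (p ＋ x - y) ⊆ q ─ p
  shrinks z∈ with x∈p─q⁻ q _ z∈
  ... | z∈q , z∉ = x∈p∧x∉q⇒x∈p─q z∈q (λ z∈p → z∉ (x∈p∧x≢z⇒x∈p＋y-z x z∈p (≢y z∈q)))
  x∉q─[p＋x-y] : x ∉ q ─ (p ＋ x - y)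
  x∉q─[p＋x-y] x∈ with x∈p─q⁻ q _ x∈
  ... | _ , x∉ = x∉ (x∈p∧x≢y⇒x∈p-y (x∈p＋x p x) (≢y x∈q))

module _ {n : ℕ} (F : Family n) where

  Deletable : Subset n → Subset n → Set
  Deletable X Y = Σ (Fin n) (λ j → j ∈ Y × j ∉ X × F (Y - j))

  Swappable : Subset n → Subset n → Set
  Swappable X Y = Σ (Fin n) (λ i → Σ (Fin n) (λ j →
    i ∈ X × i ∉ Y × j ∈ Y × j ∉ X × F (Y ＋ i - j)))

  module _ (exchange : Exchange F) where

    deletable : ∀ X Y → F X → F Y → ∣ X ∣ < ∣ Y ∣ → Deletable X Y
    deletable X Y FX FY = go X (<-wellFounded ∣ Y ─ X ∣) FX
      where
      go : ∀ X → Acc _<_ ∣ Y ─ X ∣ → F X → ∣ X ∣ < ∣ Y ∣ → Deletable X Y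
      go X (acc smaller) FX ∣X∣<∣Y∣ with nonempty? (Y ─ X)
      ... | no empty = contradiction (p⊆q⇒∣p∣≤∣q∣ (Empty[p─q]⇒p⊆q empty)) (<⇒≱ ∣X∣<∣Y∣)
      ... | yes (j , j∈Y─X) with x∈p─q⁻ Y X j∈Y─X
      ... | j∈Y , j∉X with exchange Y X j FY FX j∈Y j∉X
      ... | inj₁ (FY-j , _) = j , j∈Y , j∉X , FY-j
      ... | inj₂ (k , k∈X , k∉Y , _ , FX′) with go (X ＋ j - k) (smaller closer) FX′ ∣X′∣<∣Y∣
        where
        closer : ∣ Y ─ (X ＋ j - k) ∣ < ∣ Y ─ X ∣
        closer = p⊂q⇒∣p∣<∣q∣ (q─[p＋x-y]⊂q─p j∈Y─X k∉Y)
        ∣X′∣<∣Y∣ : ∣ X ＋ j - k ∣ < ∣ Y ∣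
        ∣X′∣<∣Y∣ = subst (_< ∣ Y ∣) (sym (∣p＋x-y∣≡∣p∣ j∉X k∈X)) ∣X∣<∣Y∣
      ... | j′ , j′∈Y , j′∉X′ , FY-j′ = j′ , j′∈Y , j′∉X , FY-j′
        where
        j′∉X : j′ ∉ X
        j′∉X j′∈X = j′∉X′ (x∈p∧x≢z⇒x∈p＋y-z j j′∈X (λ { refl → k∉Y j′∈Y }))

    swappable : ∀ X Y i → F X → F Y → ∣ X ∣ ≤ ∣ Y ∣ → i ∈ X ─ Y → Swappable X Y
    swappable X Y i FX FY ∣X∣≤∣Y∣ i∈X─Y with x∈p─q⁻ X Y i∈X─Y
    ... | i∈X , i∉Y with exchange X Y i FX FY i∈X i∉Y
    ... | inj₂ (j , j∈Y , j∉X , _ , FY＋i-j) = i , j , i∈X , i∉Y , j∈Y , j∉X , FY＋i-j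
    ... | inj₁ (_ , FY＋i) with deletable X (Y ＋ i) FX FY＋i ∣X∣<∣Y＋i∣
      where
      ∣X∣<∣Y＋i∣ : ∣ X ∣ < ∣ Y ＋ i ∣
      ∣X∣<∣Y＋i∣ = ≤-trans (s≤s ∣X∣≤∣Y∣) (≤-reflexive (sym (∣p＋x∣≡1+∣p∣ Y i i∉Y)))
    ... | j , j∈Y＋i , j∉X , FY＋i-j = i , j , i∈X , i∉Y , j∈Y , j∉X , FY＋i-j
      where
      j∈Y : j ∈ Y
      j∈Y with x∈p＋y⁻ Y i j∈Y＋i
      ... | inj₁ j∈Y = j∈Y
      ... | inj₂ refl = contradiction i∈X j∉X

    swappable-≡ : ∀ X Y → F X → F Y → ∣ X ∣ ≡ ∣ Y ∣ → X ≢ Y → Swappable X Y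
    swappable-≡ X Y FX FY ∣X∣≡∣Y∣ X≢Y with nonempty? (X ─ Y)
    ... | yes (i , i∈X─Y) = swappable X Y i FX FY (≤-reflexive ∣X∣≡∣Y∣) i∈X─Y
    ... | no empty = contradiction
      (p⊆q∧∣q∣≤∣p∣⇒p≡q (Empty[p─q]⇒p⊆q empty) (≤-reflexive (sym ∣X∣≡∣Y∣))) X≢Y

proposition3p1 : ∀ (n : ℕ) (F : Family n) → Exchange F →
    (∀ (X Y : Subset n) → F X → F Y → ∣ X ∣ < ∣ Y ∣ →
      Σ (Fin n) (λ j → j ∈ Y × j ∉ X × F (Y - j)))
    × (∀ (X Y : Subset n) → F X → F Y → ∣ X ∣ ≡ ∣ Y ∣ → ¬ X ≡ Y →
      Σ (Fin n) (λ i → Σ (Fin n) (λ j →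
        i ∈ X × i ∉ Y × j ∈ Y × j ∉ X × F (Y ＋ i - j))))
    × (∀ (X Y : Subset n) → F X → F Y → ∣ X ∣ < ∣ Y ∣ → Nonempty (X ─ Y) →
      Σ (Fin n) (λ i → Σ (Fin n) (λ j →
        i ∈ X × i ∉ Y × j ∈ Y × j ∉ X × F (Y ＋ i - j))))
proposition3p1 n F exchange =
    deletable F exchange
  , swappable-≡ F exchange
  , λ X Y FX FY ∣X∣<∣Y∣ (i , i∈X─Y) →
      swappable F exchange X Y i FX FY (≤-trans (n≤1+n _) ∣X∣<∣Y∣) i∈X─Y
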